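{- Let $\mathbf t$, $\varphi$ and $\mathcal Z(\cdot)$ be as in the context. Let $N\in\mathbb N$ have normal $T$-representation $\langle N\rangle_T=1d_{k-1}\cdots d_1d_0$ with $k\ge1$, and let $n$ be the number with $\langle n\rangle_T=1d_{k-1}\cdots d_1$. Then $$\mathcal Z(N)=\bigcup_{\zeta\in\mathcal Z(n)}\mathcal D_0(\zeta)\qquad\text{or}\qquad \mathcal Z(N)=\bigcup_{\zeta\in\mathcal Z(n)}\mathcal D_1(\zeta).$$
   Context: The Tribonacci word $\mathbf t$ is the fixed point of $\varphi:0\mapsto01,\ 1\mapsto02,\ 2\mapsto0$. Tribonacci numbers: $T_0=T_1=0$, $T_2=1$, $T_j=T_{j-1}+T_{j-2}+T_{j-3}$. The normal $T$-representation $\langle n\rangle_T=d_k\cdots d_0$ is the digit string with $d_j\in\{0,1\}$, $n=\sum_j d_jT_{j+3}$, obtained by the greedy algorithm. $\Psi(w)=(|w|_0,|w|_1,|w|_2)$ is the Parikh vector. For words $v,w$ with $\Psi(v)=\Psi(w)$, factorize $v=z_0\cdots z_h$, $w=\tilde z_0\cdots\tilde z_h$ with nonempty $z_j,\tilde z_j$, $\Psi(z_j)=\Psi(\tilde z_j)$, $h$ maximal; $\mathrm{Dec}\binom{v}{w}=\{\binom{z_j}{\tilde z_j}\}$. $x^{ -1}y$ denotes $y$ with its prefix $x$ deleted. For $\zeta=\binom{z}{\tilde z}$ with $\Psi(z)=\Psi(\tilde z)$ (factors of $\mathbf t$), $\mathcal D_0(\zeta)=\mathrm{Dec}\binom{\varphi(z)}{\varphi(\tilde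 z)}$ and $\mathcal D_1(\zeta)=\mathrm{Dec}\binom{\varphi(z)}{0^{ -1}\varphi(\tilde z)0}$. With $\mathbf t_{[n]}$ the length-$n$ prefix of $\mathbf t$, $\mathcal Z(n)=\mathrm{Dec}\binom{\varphi^{K+3}(0)}{\mathbf t_{[n]}^{ -1}\varphi^{K+3}(0)\mathbf t_{[n]}}$ for any integer $K\ge0$ with $n\le T_{K+3}$ (independent of such $K$). -}

module Defs where

open import Data.Nat using (ℕ; zero; suc; _+_; _∸_; _≤ᵇ_; _≡ᵇ_)
open import Data.Bool using (Bool; true; false; if_then_else_; _∧_)
open import Data.List using (List; []; _∷_; _++_; [_]; concatMap; take; drop; length; _∷ʳ_)
open import Data.Product using (_×_; _,_; Σ; ∃-syntax)
open import Data.List.Membership.Propositional using (_∈_)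
open import Function.Bundles using (_⇔_)

data Letter : Set where
  l0 l1 l2 : Letter

Word : Set
Word = List Letter

φ₁ : Letter → Word
φ₁ l0 = l0 ∷ l1 ∷ []
φ₁ l1 = l0 ∷ l2 ∷ []
φ₁ l2 = l0 ∷ []

φ : Word → Word
φ = concatMap φ₁

φ^ : ℕ → Word → Word
φ^ zero w = w
φ^ (suc k) w = φ (φ^ k w)

T : ℕ → ℕ
T 0 = 0
T 1 = 0
T 2 = 1
T (suc (suc (suc j))) = T (suc (suc j)) + T (suc j) + T j

-- Length-n prefix t_[n] of the Tribonacci word t.
-- φ^n(0) is a prefix of t of length T_{n+3} ≥ n.
tPrefix : ℕ → Word
tPrefix n = take n (φ^ n (l0 ∷ []))

_⁻¹·_ : Word → Word → Word
x ⁻¹· y = drop (length x) y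

-- Greedy T-representation.
-- greedy j r : digits d_{j-1} ⋯ d_0 (most significant first) obtained greedily
-- for remainder r, digit d_i having weight T_{i+3}.
greedy : ℕ → ℕ → List ℕ
greedy zero r = []
greedy (suc j) r =
  if T (j + 3) ≤ᵇ r then 1 ∷ greedy j (r ∸ T (j + 3)) else 0 ∷ greedy j r

stripZeros : List ℕ → List ℕ
stripZeros [] = []
stripZeros (zero ∷ ds) = stripZeros ds
stripZeros (suc d ∷ ds) = suc d ∷ ds

-- Normal T-representation ⟨N⟩_T (most significant digit first, no leading zeros).
-- Positions N, …, 0 suffice since T_{N+3} > N.
⟨_⟩T : ℕ → List ℕ
⟨ N ⟩T = stripZeros (greedy (suc N) N)

cnt : Letter → Word → ℕ
cnt a [] = 0
cnt l0 (l0 ∷ w) = suc (cnt l0 w)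
cnt l1 (l1 ∷ w) = suc (cnt l1 w)
cnt l2 (l2 ∷ w) = suc (cnt l2 w)
cnt a (_ ∷ w) = cnt a w

Ψ : Word → ℕ × ℕ × ℕ
Ψ w = cnt l0 w , cnt l1 w , cnt l2 w

sameΨ : Word → Word → Bool
sameΨ v w = (cnt l0 v ≡ᵇ cnt l0 w) ∧ ((cnt l1 v ≡ᵇ cnt l1 w) ∧ (cnt l2 v ≡ᵇ cnt l2 w))

Pair : Set
Pair = Word × Word

-- Dec(v / w): the factorization with the maximal number of blocks with equal
-- Parikh vectors; it cuts exactly at every position where the prefixes of v
-- and w have equal Parikh vectors.  (Given as a list; used as a set via ∈.)
decGo : Word → Word → Word → Word → List Pair
decGo (a ∷ v) (b ∷ w) accv accw =
  if sameΨ (accv ∷ʳ a) (accw ∷ʳ b)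
  then (accv ∷ʳ a , accw ∷ʳ b) ∷ decGo v w [] []
  else decGo v w (accv ∷ʳ a) (accw ∷ʳ b)
decGo _ _ _ _ = []

Dec : Word → Word → List Pair
Dec v w = decGo v w [] []

𝒟₀ : Pair → List Pair
𝒟₀ (z , z̃) = Dec (φ z) (φ z̃)

𝒟₁ : Pair → List Pair
𝒟₁ (z , z̃) = Dec (φ z) ((l0 ∷ []) ⁻¹· (φ z̃ ++ (l0 ∷ [])))

-- 𝒵 with an explicit K (requires n ≤ T_{K+3}); the paper notes independence of K.
𝒵K : ℕ → ℕ → List Pair
𝒵K K n = Dec (φ^ (K + 3) (l0 ∷ [])) (tPrefix n ⁻¹· (φ^ (K + 3) (l0 ∷ []) ++ tPrefix n))

-- 𝒵(n), using the admissible choice K = n (n ≤ T_{n+3}).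
𝒵 : ℕ → List Pair
𝒵 n = 𝒵K n n

⋃ : List Pair → (Pair → List Pair) → List Pair
⋃ Z D = concatMap D Z

_≐_ : List Pair → List Pair → Set
A ≐ B = ∀ x → (x ∈ A) ⇔ (x ∈ B)

-- If Ψ(v) = Ψ(w) then Ψ(φ v) = Ψ(φ w), so Dec commutes with φ: the blocks of
-- Dec(φ v, φ w) are the blocks of the images of the blocks of Dec(v, w), and the same holds
-- with φ replaced by its conjugate 0⁻¹φ0 in the second component. Deleting the last digit
-- d₀ of ⟨N⟩_T gives t_[N] = φ(t_[n]) 0^{d₀}, so the conjugate t_[N]⁻¹ φ^{K+4}(0) t_[N] is
-- the image of t_[n]⁻¹ φ^{K+3}(0) t_[n] under φ (d₀ = 0) or 0⁻¹φ0 (d₀ = 1). It remains to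
-- see that 𝒵 does not depend on K: every prefix of t is φ(t_[n]) or φ(t_[n])0, so the same
-- argument reduces K + 1 to K, down to K = 0, 1, where both sides are computed.

module Submission where

open import Defs
open import Data.Bool using (true; false) renaming (T to Tᵇ)
open import Data.Bool.Properties using (T-∧)
open import Data.Empty using (⊥-elim)
open import Data.List using (List; []; _∷_; _++_; [_]; concatMap; replicate; take; drop; length; _∷ʳ_)
open import Data.List.Properties
  using (∷-injectiveʳ; ++-assoc; ++-identityʳ; ++-identityʳ-unique; ∷ʳ-++; concatMap-++; length-++;
         drop-drop; take++drop≡id)
  renaming (≡-dec to List-≡-dec)
open import Data.List.Relation.Unary.All using (All; []; _∷_)
open import Data.List.Relation.Unary.All.Properties using (∷ʳ⁻)
open import Data.List.Relation.Binary.Subset.Propositional using (_⊆_)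
open import Data.List.Relation.Binary.Subset.Propositional.Properties using (concatMap⁺)
open import Data.Nat using (ℕ; zero; suc; _+_; _∸_; _≤ᵇ_; _≤_; _<_; _≤′_; ≤′-reflexive; ≤′-step; z≤n; s≤s)
open import Data.Nat.Properties
  using (+-comm; +-assoc; +-suc; +-cancelˡ-≡; +-cancelˡ-<; +-monoʳ-≤; suc-injective; ≡ᵇ⇒≡; ≡⇒≡ᵇ;
         ≤ᵇ-reflects-≤; _≤?_; ≤-refl; ≤-reflexive; ≤-trans; ≤-total; <⇒≤; ≰⇒>; ≤⇒≤′; ≤′⇒≤;
         m≤m+n; m≤n+m; m<m+n; n≤1+n; m≤n⇒m≤1+n; m+[n∸m]≡n; m≤n⇒∃[o]m+o≡n)
open import Data.Product using (_×_; _,_; proj₁; proj₂; ∃-syntax)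
open import Data.Product.Properties using (,-injective) renaming (≡-dec to ×-≡-dec)
open import Data.Sum using (_⊎_; inj₁; inj₂)
open import Function using (_∘_; id; Equivalence; mk⇔)
import Function.Properties.Equivalence as ⇔
open import Relation.Binary.Bundles using (Setoid)
open import Relation.Binary.Definitions using (DecidableEquality)
open import Relation.Binary.PropositionalEquality hiding ([_])
open import Relation.Nullary using (¬_; yes; no)
open import Relation.Nullary.Decidable using (from-yes)
open import Relation.Nullary.Reflects using (Reflects; ofʸ; ofⁿ; fromEquivalence)

open ≡-Reasoning

ℕ³ : Set
ℕ³ = ℕ × ℕ × ℕ

_⊕_ : ℕ³ → ℕ³ → ℕ³
(a , b , c) ⊕ (a′ , b′ , c′) = a + a′ , b + b′ , c + c′

⊕-comm : ∀ u v → u ⊕ v ≡ v ⊕ u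
⊕-comm (a , b , c) (a′ , b′ , c′) =
  cong₂ _,_ (+-comm a a′) (cong₂ _,_ (+-comm b b′) (+-comm c c′))

⊕-cancelˡ : ∀ u {v w} → u ⊕ v ≡ u ⊕ w → v ≡ w
⊕-cancelˡ (a , b , c) {_ , _ , _} {_ , _ , _} e
  with ,-injective e
... | ea , ebc with ,-injective ebc
... | eb , ec = cong₂ _,_ (+-cancelˡ-≡ a _ _ ea) (cong₂ _,_ (+-cancelˡ-≡ b _ _ eb) (+-cancelˡ-≡ c _ _ ec))

Ψ-++ : ∀ x y → Ψ (x ++ y) ≡ Ψ x ⊕ Ψ y
Ψ-++ []       y = refl
Ψ-++ (l0 ∷ x) y = cong (λ { (a , b , c) → suc a , b , c }) (Ψ-++ x y)
Ψ-++ (l1 ∷ x) y = cong (λ { (a , b , c) → a , suc b , c }) (Ψ-++ x y)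
Ψ-++ (l2 ∷ x) y = cong (λ { (a , b , c) → a , b , suc c }) (Ψ-++ x y)

Ψ-++-comm : ∀ x y → Ψ (x ++ y) ≡ Ψ (y ++ x)
Ψ-++-comm x y = begin
  Ψ (x ++ y)    ≡⟨ Ψ-++ x y ⟩
  Ψ x ⊕ Ψ y     ≡⟨ ⊕-comm (Ψ x) (Ψ y) ⟩
  Ψ y ⊕ Ψ x     ≡⟨ Ψ-++ y x ⟨
  Ψ (y ++ x)    ∎

Ψ-++-cancelˡ : ∀ x y x′ y′ → Ψ x ≡ Ψ x′ → Ψ (x ++ y) ≡ Ψ (x′ ++ y′) → Ψ y ≡ Ψ y′
Ψ-++-cancelˡ x y x′ y′ ex e = ⊕-cancelˡ (Ψ x) (begin
  Ψ x ⊕ Ψ y     ≡⟨ Ψ-++ x y ⟨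
  Ψ (x ++ y)    ≡⟨ e ⟩
  Ψ (x′ ++ y′)  ≡⟨ Ψ-++ x′ y′ ⟩
  Ψ x′ ⊕ Ψ y′   ≡⟨ cong (_⊕ Ψ y′) ex ⟨
  Ψ x ⊕ Ψ y′    ∎)

total : ℕ³ → ℕ
total (a , b , c) = a + (b + c)

length-Ψ : ∀ w → length w ≡ total (Ψ w)
length-Ψ []       = refl
length-Ψ (l0 ∷ w) = cong suc (length-Ψ w)
length-Ψ (l1 ∷ w) = trans (cong suc (length-Ψ w)) (sym (+-suc (cnt l0 w) _))
length-Ψ (l2 ∷ w) = trans (cong suc (length-Ψ w))
  (sym (trans (cong (cnt l0 w +_) (+-suc (cnt l1 w) _)) (+-suc (cnt l0 w) _)))

Ψ⇒length : ∀ x y → Ψ x ≡ Ψ y → length x ≡ length y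
Ψ⇒length x y e = trans (length-Ψ x) (trans (cong total e) (sym (length-Ψ y)))

sameΨ-reflects : ∀ v w → Reflects (Ψ v ≡ Ψ w) (sameΨ v w)
sameΨ-reflects v w = fromEquivalence sound complete
  where
  sound : Tᵇ (sameΨ v w) → Ψ v ≡ Ψ w
  sound t with Equivalence.to T-∧ t
  ... | t₀ , t₁₂ with Equivalence.to T-∧ t₁₂
  ... | t₁ , t₂ = cong₂ _,_ (≡ᵇ⇒≡ _ _ t₀) (cong₂ _,_ (≡ᵇ⇒≡ _ _ t₁) (≡ᵇ⇒≡ _ _ t₂))
  complete : Ψ v ≡ Ψ w → Tᵇ (sameΨ v w)
  complete e with ,-injective e
  ... | e₀ , e₁₂ with ,-injective e₁₂
  ... | e₁ , e₂ =
    Equivalence.from T-∧ (≡⇒≡ᵇ _ _ e₀ , Equivalence.from T-∧ (≡⇒≡ᵇ _ _ e₁ , ≡⇒≡ᵇ _ _ e₂))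

Ψ-∷ʳ-++ : ∀ av aw {a b x x′} → Ψ (av ++ a ∷ x) ≡ Ψ (aw ++ b ∷ x′) →
  Ψ ((av ∷ʳ a) ++ x) ≡ Ψ ((aw ∷ʳ b) ++ x′)
Ψ-∷ʳ-++ av aw {a} {b} {x} {x′} rewrite ∷ʳ-++ av a x | ∷ʳ-++ aw b x′ = id

-- Invariant of the accumulators of decGo: nothing is pending, or the pending block is
-- unbalanced (a balanced one would already have been cut).
Open : Word → Word → Set
Open av aw = (av ≡ [] × aw ≡ []) ⊎ ¬ (Ψ av ≡ Ψ aw)

Open-balanced⇒empty : ∀ {av aw} → Open av aw → Ψ (av ++ []) ≡ Ψ (aw ++ []) → av ≡ [] × aw ≡ []
Open-balanced⇒empty (inj₁ empty) _ = empty
Open-balanced⇒empty {av} {aw} (inj₂ unbalanced) e =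
  ⊥-elim (unbalanced (subst₂ (λ u v → Ψ u ≡ Ψ v) (++-identityʳ av) (++-identityʳ aw) e))

decGo-++ : ∀ x x′ y y′ av aw → length x ≡ length x′ → Ψ (av ++ x) ≡ Ψ (aw ++ x′) → Open av aw →
  decGo (x ++ y) (x′ ++ y′) av aw ≡ decGo x x′ av aw ++ Dec y y′
decGo-++ []      []       y y′ av aw _ e open′ with Open-balanced⇒empty open′ e
... | refl , refl = refl
decGo-++ []      (_ ∷ _)  y y′ av aw () _ _
decGo-++ (_ ∷ _) []       y y′ av aw () _ _
decGo-++ (a ∷ x) (b ∷ x′) y y′ av aw l e _
  with sameΨ (av ∷ʳ a) (aw ∷ʳ b) | sameΨ-reflects (av ∷ʳ a) (aw ∷ʳ b)
... | _ | ofʸ cut = cong (_ ∷_) (decGo-++ x x′ y y′ [] [] (suc-injective l)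
      (Ψ-++-cancelˡ (av ∷ʳ a) x (aw ∷ʳ b) x′ cut (Ψ-∷ʳ-++ av aw e)) (inj₁ (refl , refl)))
... | _ | ofⁿ no-cut =
      decGo-++ x x′ y y′ (av ∷ʳ a) (aw ∷ʳ b) (suc-injective l) (Ψ-∷ʳ-++ av aw e) (inj₂ no-cut)

Dec-++ : ∀ x x′ y y′ → Ψ x ≡ Ψ x′ → Dec (x ++ y) (x′ ++ y′) ≡ Dec x x′ ++ Dec y y′
Dec-++ x x′ y y′ e = decGo-++ x x′ y y′ [] [] (Ψ⇒length x x′ e) e (inj₁ (refl , refl))

module _ (g f : Word → Word)
         (g-++ : ∀ x y → g (x ++ y) ≡ g x ++ g y)
         (f-++ : ∀ x y → f (x ++ y) ≡ f x ++ f y)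
         (Ψ-g-f : ∀ x y → Ψ x ≡ Ψ y → Ψ (g x) ≡ Ψ (f y)) where

  decGo-morphism : ∀ v w av aw → length v ≡ length w → Ψ (av ++ v) ≡ Ψ (aw ++ w) → Open av aw →
    Dec (g (av ++ v)) (f (aw ++ w)) ≡ concatMap (λ ζ → Dec (g (proj₁ ζ)) (f (proj₂ ζ))) (decGo v w av aw)
  decGo-morphism []      []      av aw _ e open′ with Open-balanced⇒empty open′ e
  ... | refl , refl = cong (λ u → Dec u (f [])) (++-identityʳ-unique (g []) (g-++ [] []))
  decGo-morphism []      (_ ∷ _) av aw () _ _
  decGo-morphism (_ ∷ _) []      av aw () _ _
  decGo-morphism (a ∷ v) (b ∷ w) av aw l e _
    with sameΨ (av ∷ʳ a) (aw ∷ʳ b) | sameΨ-reflects (av ∷ʳ a) (aw ∷ʳ b)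
  ... | _ | ofʸ cut = begin
      Dec (g (av ++ a ∷ v)) (f (aw ++ b ∷ w))
        ≡⟨ cong₂ Dec (cong g (sym (∷ʳ-++ av a v))) (cong f (sym (∷ʳ-++ aw b w))) ⟩
      Dec (g ((av ∷ʳ a) ++ v)) (f ((aw ∷ʳ b) ++ w))
        ≡⟨ cong₂ Dec (g-++ (av ∷ʳ a) v) (f-++ (aw ∷ʳ b) w) ⟩
      Dec (g (av ∷ʳ a) ++ g v) (f (aw ∷ʳ b) ++ f w)
        ≡⟨ Dec-++ (g (av ∷ʳ a)) (f (aw ∷ʳ b)) (g v) (f w) (Ψ-g-f (av ∷ʳ a) (aw ∷ʳ b) cut) ⟩
      Dec (g (av ∷ʳ a)) (f (aw ∷ʳ b)) ++ Dec (g v) (f w)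
        ≡⟨ cong (Dec (g (av ∷ʳ a)) (f (aw ∷ʳ b)) ++_) (decGo-morphism v w [] [] (suc-injective l)
             (Ψ-++-cancelˡ (av ∷ʳ a) v (aw ∷ʳ b) w cut (Ψ-∷ʳ-++ av aw e)) (inj₁ (refl , refl))) ⟩
      _ ∎
  ... | _ | ofⁿ no-cut = trans
      (cong₂ Dec (cong g (sym (∷ʳ-++ av a v))) (cong f (sym (∷ʳ-++ aw b w))))
      (decGo-morphism v w (av ∷ʳ a) (aw ∷ʳ b) (suc-injective l) (Ψ-∷ʳ-++ av aw e) (inj₂ no-cut))

  Dec-morphism : ∀ v w → Ψ v ≡ Ψ w →
    Dec (g v) (f w) ≡ concatMap (λ ζ → Dec (g (proj₁ ζ)) (f (proj₂ ζ))) (Dec v w)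
  Dec-morphism v w e = decGo-morphism v w [] [] (Ψ⇒length v w e) e (inj₁ (refl , refl))

φ-++ : ∀ x y → φ (x ++ y) ≡ φ x ++ φ y
φ-++ = concatMap-++ φ₁

Ψ-φ : ∀ w → Ψ (φ w) ≡ (length w , cnt l0 w , cnt l1 w)
Ψ-φ []       = refl
Ψ-φ (l0 ∷ w) = cong (λ { (a , b , c) → suc a , suc b , c }) (Ψ-φ w)
Ψ-φ (l1 ∷ w) = cong (λ { (a , b , c) → suc a , b , suc c }) (Ψ-φ w)
Ψ-φ (l2 ∷ w) = cong (λ { (a , b , c) → suc a , b , c }) (Ψ-φ w)

φ-respects-Ψ : ∀ x y → Ψ x ≡ Ψ y → Ψ (φ x) ≡ Ψ (φ y)
φ-respects-Ψ x y e = begin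
  Ψ (φ x)                            ≡⟨ Ψ-φ x ⟩
  (length x , cnt l0 x , cnt l1 x)   ≡⟨ cong₂ _,_ (Ψ⇒length x y e) (cong (λ { (a , b , _) → a , b }) e) ⟩
  (length y , cnt l0 y , cnt l1 y)   ≡⟨ Ψ-φ y ⟨
  Ψ (φ y)                            ∎

conjφ : Word → Word
conjφ w = (l0 ∷ []) ⁻¹· (φ w ++ l0 ∷ [])

l0∷conjφ : ∀ w → l0 ∷ conjφ w ≡ φ w ++ [ l0 ]
l0∷conjφ []       = refl
l0∷conjφ (l0 ∷ w) = refl
l0∷conjφ (l1 ∷ w) = refl
l0∷conjφ (l2 ∷ w) = refl

conjφ-++ : ∀ x y → conjφ (x ++ y) ≡ conjφ x ++ conjφ y
conjφ-++ x y = ∷-injectiveʳ (begin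
  l0 ∷ conjφ (x ++ y)          ≡⟨ l0∷conjφ (x ++ y) ⟩
  φ (x ++ y) ++ [ l0 ]         ≡⟨ cong (_++ [ l0 ]) (φ-++ x y) ⟩
  (φ x ++ φ y) ++ [ l0 ]       ≡⟨ ++-assoc (φ x) (φ y) [ l0 ] ⟩
  φ x ++ (φ y ++ [ l0 ])       ≡⟨ cong (φ x ++_) (l0∷conjφ y) ⟨
  φ x ++ l0 ∷ conjφ y          ≡⟨ ∷ʳ-++ (φ x) l0 (conjφ y) ⟨
  (φ x ++ [ l0 ]) ++ conjφ y   ≡⟨ cong (_++ conjφ y) (l0∷conjφ x) ⟨
  l0 ∷ conjφ x ++ conjφ y      ∎)

Ψ-conjφ : ∀ w → Ψ (conjφ w) ≡ Ψ (φ w)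
Ψ-conjφ w = Ψ-++-cancelˡ [ l0 ] (conjφ w) [ l0 ] (φ w) refl
  (trans (cong Ψ (l0∷conjφ w)) (Ψ-++-comm (φ w) [ l0 ]))

Dec-φ : ∀ v w → Ψ v ≡ Ψ w → Dec (φ v) (φ w) ≡ ⋃ (Dec v w) 𝒟₀
Dec-φ = Dec-morphism φ φ φ-++ φ-++ φ-respects-Ψ

Dec-conjφ : ∀ v w → Ψ v ≡ Ψ w → Dec (φ v) (conjφ w) ≡ ⋃ (Dec v w) 𝒟₁
Dec-conjφ = Dec-morphism φ conjφ φ-++ conjφ-++
  (λ x y e → trans (φ-respects-Ψ x y e) (sym (Ψ-conjφ y)))

rotate : Word → Word → Word
rotate p w = p ⁻¹· (w ++ p)

Dec-rotate : Word → Word → List Pair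
Dec-rotate p w = Dec w (rotate p w)

⁻¹·-++ : ∀ x y → x ⁻¹· (x ++ y) ≡ y
⁻¹·-++ []      y = refl
⁻¹·-++ (_ ∷ x) y = ⁻¹·-++ x y

rotate-++ : ∀ x y → rotate x (x ++ y) ≡ y ++ x
rotate-++ x y = trans (cong (x ⁻¹·_) (++-assoc x y x)) (⁻¹·-++ x (y ++ x))

rotate-++-++ : ∀ x s y → rotate (x ++ s) (x ++ y) ≡ s ⁻¹· (y ++ x ++ s)
rotate-++-++ x s y = begin
  drop (length (x ++ s)) ((x ++ y) ++ x ++ s)   ≡⟨ cong₂ drop (length-++ x) (++-assoc x y (x ++ s)) ⟩
  drop (length x + length s) (x ++ y ++ x ++ s) ≡⟨ drop-drop (length x) (length s) _ ⟨
  s ⁻¹· (x ⁻¹· (x ++ y ++ x ++ s))              ≡⟨ cong (s ⁻¹·_) (⁻¹·-++ x (y ++ x ++ s)) ⟩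
  s ⁻¹· (y ++ x ++ s)                           ∎

_≼_ : Word → Word → Set
x ≼ y = ∃[ s ] y ≡ x ++ s

Dec-φ-rotate : ∀ {p w} → p ≼ w → Dec-rotate (φ p) (φ w) ≡ ⋃ (Dec-rotate p w) 𝒟₀
Dec-φ-rotate {p} (q , refl) = begin
  Dec (φ (p ++ q)) (rotate (φ p) (φ (p ++ q)))   ≡⟨ cong (Dec (φ (p ++ q)) ∘ rotate (φ p)) (φ-++ p q) ⟩
  Dec (φ (p ++ q)) (rotate (φ p) (φ p ++ φ q))   ≡⟨ cong (Dec (φ (p ++ q))) (rotate-++ (φ p) (φ q)) ⟩
  Dec (φ (p ++ q)) (φ q ++ φ p)                  ≡⟨ cong (Dec (φ (p ++ q))) (φ-++ q p) ⟨
  Dec (φ (p ++ q)) (φ (q ++ p))                  ≡⟨ Dec-φ (p ++ q) (q ++ p) (Ψ-++-comm p q) ⟩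
  ⋃ (Dec (p ++ q) (q ++ p)) 𝒟₀                   ≡⟨ cong (λ w → ⋃ (Dec (p ++ q) w) 𝒟₀) (rotate-++ p q) ⟨
  ⋃ (Dec (p ++ q) (rotate p (p ++ q))) 𝒟₀        ∎

Dec-φ0-rotate : ∀ {p w} → p ≼ w → Dec-rotate (φ p ++ [ l0 ]) (φ w) ≡ ⋃ (Dec-rotate p w) 𝒟₁
Dec-φ0-rotate {p} (q , refl) = begin
  Dec (φ (p ++ q)) (rotate (φ p ++ [ l0 ]) (φ (p ++ q)))
    ≡⟨ cong (Dec (φ (p ++ q)) ∘ rotate (φ p ++ [ l0 ])) (φ-++ p q) ⟩
  Dec (φ (p ++ q)) (rotate (φ p ++ [ l0 ]) (φ p ++ φ q))
    ≡⟨ cong (Dec (φ (p ++ q))) (rotate-++-++ (φ p) [ l0 ] (φ q)) ⟩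
  Dec (φ (p ++ q)) ([ l0 ] ⁻¹· (φ q ++ φ p ++ [ l0 ]))
    ≡⟨ cong (λ w → Dec (φ (p ++ q)) ([ l0 ] ⁻¹· w)) (++-assoc (φ q) (φ p) [ l0 ]) ⟨
  Dec (φ (p ++ q)) ([ l0 ] ⁻¹· ((φ q ++ φ p) ++ [ l0 ]))
    ≡⟨ cong (λ w → Dec (φ (p ++ q)) ([ l0 ] ⁻¹· (w ++ [ l0 ]))) (φ-++ q p) ⟨
  Dec (φ (p ++ q)) (conjφ (q ++ p))
    ≡⟨ Dec-conjφ (p ++ q) (q ++ p) (Ψ-++-comm p q) ⟩
  ⋃ (Dec (p ++ q) (q ++ p)) 𝒟₁
    ≡⟨ cong (λ w → ⋃ (Dec (p ++ q) w) 𝒟₁) (rotate-++ p q) ⟨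
  ⋃ (Dec (p ++ q) (rotate p (p ++ q))) 𝒟₁
    ∎

Φ : ℕ → Letter → Word
Φ k a = φ^ k [ a ]

φ^-++ : ∀ k x y → φ^ k (x ++ y) ≡ φ^ k x ++ φ^ k y
φ^-++ zero    x y = refl
φ^-++ (suc k) x y = trans (cong φ (φ^-++ k x y)) (φ-++ (φ^ k x) (φ^ k y))

φ^-suc : ∀ k w → φ^ (suc k) w ≡ φ^ k (φ w)
φ^-suc zero    w = refl
φ^-suc (suc k) w = cong φ (φ^-suc k w)

Φ-suc-l0 : ∀ k → Φ (suc k) l0 ≡ Φ k l0 ++ Φ k l1
Φ-suc-l0 k = trans (φ^-suc k _) (φ^-++ k [ l0 ] [ l1 ])

Φ-suc-l1 : ∀ k → Φ (suc k) l1 ≡ Φ k l0 ++ Φ k l2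
Φ-suc-l1 k = trans (φ^-suc k _) (φ^-++ k [ l0 ] [ l2 ])

Φ-suc-l2 : ∀ k → Φ (suc k) l2 ≡ Φ k l0
Φ-suc-l2 k = φ^-suc k _

Φ-length-suc-l0 : ∀ k → length (Φ (suc k) l0) ≡ length (Φ k l0) + length (Φ k l1)
Φ-length-suc-l0 k = trans (cong length (Φ-suc-l0 k)) (length-++ (Φ k l0))

Φ-length-l0 : ∀ k → length (Φ k l0) ≡ T (3 + k)
Φ-length-l1 : ∀ k → length (Φ k l1) ≡ T (2 + k) + T (1 + k)
Φ-length-l2 : ∀ k → length (Φ k l2) ≡ T (2 + k)

Φ-length-l0 zero    = refl
Φ-length-l0 (suc k) = begin
  length (Φ (suc k) l0)                     ≡⟨ Φ-length-suc-l0 k ⟩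
  length (Φ k l0) + length (Φ k l1)         ≡⟨ cong₂ _+_ (Φ-length-l0 k) (Φ-length-l1 k) ⟩
  T (3 + k) + (T (2 + k) + T (1 + k))       ≡⟨ +-assoc (T (3 + k)) _ _ ⟨
  T (4 + k)                                 ∎

Φ-length-l1 zero    = refl
Φ-length-l1 (suc k) = trans (cong length (Φ-suc-l1 k))
  (trans (length-++ (Φ k l0)) (cong₂ _+_ (Φ-length-l0 k) (Φ-length-l2 k)))

Φ-length-l2 zero    = refl
Φ-length-l2 (suc k) = trans (cong length (Φ-suc-l2 k)) (Φ-length-l0 k)

Φ-length-l1≤l0 : ∀ k → length (Φ k l1) ≤ length (Φ k l0)
Φ-length-l1≤l0 k rewrite Φ-length-l1 k | Φ-length-l0 k = m≤m+n _ (T k)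

T-pos : ∀ k → 1 ≤ T (2 + k)
T-pos zero    = ≤-refl
T-pos (suc k) = ≤-trans (T-pos k) (≤-trans (m≤m+n _ (T (1 + k))) (m≤m+n _ (T k)))

<-Φ-length : ∀ m → m < length (Φ m l0)
<-Φ-length zero    = s≤s z≤n
<-Φ-length (suc m) = ≤-trans (s≤s (<-Φ-length m))
  (≤-trans (m<m+n (length (Φ m l0)) 1≤Φ-length-l1) (≤-reflexive (sym (Φ-length-suc-l0 m))))
  where
  1≤Φ-length-l1 : 1 ≤ length (Φ m l1)
  1≤Φ-length-l1 rewrite Φ-length-l1 m = ≤-trans (T-pos m) (m≤m+n _ _)

take-++ˡ : ∀ {A : Set} n (x y : List A) → n ≤ length x → take n (x ++ y) ≡ take n x
take-++ˡ zero    x       y _         = refl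
take-++ˡ (suc n) (a ∷ x) y (s≤s n≤) = cong (a ∷_) (take-++ˡ n x y n≤)

take-++-length : ∀ {A : Set} (x : List A) s y → take (length x + s) (x ++ y) ≡ x ++ take s y
take-++-length []      s y = refl
take-++-length (a ∷ x) s y = cong (a ∷_) (take-++-length x s y)

≼-take : ∀ {x y} n → x ≼ y → n ≤ length x → take n y ≡ take n x
≼-take {x} n (s , refl) = take-++ˡ n x s

≼-length : ∀ {x y} → x ≼ y → length x ≤ length y
≼-length {x} (s , refl) = ≤-trans (m≤m+n _ _) (≤-reflexive (sym (length-++ x)))

take-≼ : ∀ n x → take n x ≼ x
take-≼ n x = drop n x , sym (take++drop≡id n x)

Φ-≼ : ∀ {a b} → a ≤′ b → Φ a l0 ≼ Φ b l0
Φ-≼ (≤′-reflexive refl) = [] , sym (++-identityʳ _)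
Φ-≼ {a} (≤′-step {b} a≤′b) with Φ-≼ a≤′b
... | s , e = s ++ Φ b l1 , (begin
  Φ (suc b) l0            ≡⟨ Φ-suc-l0 b ⟩
  Φ b l0 ++ Φ b l1        ≡⟨ cong (_++ Φ b l1) e ⟩
  (Φ a l0 ++ s) ++ Φ b l1 ≡⟨ ++-assoc (Φ a l0) s _ ⟩
  Φ a l0 ++ s ++ Φ b l1   ∎)

Φ-length-mono : ∀ {a b} → a ≤ b → length (Φ a l0) ≤ length (Φ b l0)
Φ-length-mono a≤b = ≼-length (Φ-≼ (≤⇒≤′ a≤b))

≤-Φ-length : ∀ {m a} → m ≤ a → m ≤ length (Φ a l0)
≤-Φ-length {m} m≤a = ≤-trans (<⇒≤ (<-Φ-length m)) (Φ-length-mono m≤a)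

tPrefix-take : ∀ {m} a → m ≤ length (Φ a l0) → tPrefix m ≡ take m (Φ a l0)
tPrefix-take {m} a m≤ with ≤-total m a
... | inj₁ m≤a = sym (≼-take m (Φ-≼ (≤⇒≤′ m≤a)) (<⇒≤ (<-Φ-length m)))
... | inj₂ a≤m = ≼-take m (Φ-≼ (≤⇒≤′ a≤m)) m≤

tPrefix-≼ : ∀ {n} a → n ≤ length (Φ a l0) → tPrefix n ≼ Φ a l0
tPrefix-≼ {n} a n≤ = subst (_≼ Φ a l0) (sym (tPrefix-take a n≤)) (take-≼ n (Φ a l0))

take-Φ-l2≡take-Φ-l1 : ∀ k r → r < length (Φ k l2) → take r (Φ k l2) ≡ take r (Φ k l1)
take-Φ-l2≡take-Φ-l1 zero    zero    _ = refl
take-Φ-l2≡take-Φ-l1 zero    (suc _) (s≤s ())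
take-Φ-l2≡take-Φ-l1 (suc k) r r<
  rewrite Φ-suc-l2 k | Φ-suc-l1 k = sym (take-++ˡ r (Φ k l0) (Φ k l2) (<⇒≤ r<))

take-Φ-l1≡take-Φ-l0 : ∀ k r → r < length (Φ k l1) → take r (Φ k l1) ≡ take r (Φ k l0)
take-Φ-l1≡take-Φ-l0 zero    zero    _ = refl
take-Φ-l1≡take-Φ-l0 zero    (suc _) (s≤s ())
take-Φ-l1≡take-Φ-l0 (suc k) r r<
  rewrite Φ-suc-l1 k | Φ-suc-l0 k with r ≤? length (Φ k l0)
... | yes r≤ = trans (take-++ˡ r (Φ k l0) (Φ k l2) r≤) (sym (take-++ˡ r (Φ k l0) (Φ k l1) r≤))
... | no r≰ with m≤n⇒∃[o]m+o≡n (<⇒≤ (≰⇒> r≰))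
...   | s , refl = begin
  take (length (Φ k l0) + s) (Φ k l0 ++ Φ k l2)   ≡⟨ take-++-length (Φ k l0) s (Φ k l2) ⟩
  Φ k l0 ++ take s (Φ k l2)                       ≡⟨ cong (Φ k l0 ++_) (take-Φ-l2≡take-Φ-l1 k s s<) ⟩
  Φ k l0 ++ take s (Φ k l1)                       ≡⟨ take-++-length (Φ k l0) s (Φ k l1) ⟨
  take (length (Φ k l0) + s) (Φ k l0 ++ Φ k l1)   ∎
  where
  s< : s < length (Φ k l2)
  s< = +-cancelˡ-< (length (Φ k l0)) s _ (subst (length (Φ k l0) + s <_) (length-++ (Φ k l0)) r<)

tPrefix-+ : ∀ k r → r < length (Φ k l1) → tPrefix (length (Φ k l0) + r) ≡ Φ k l0 ++ tPrefix r
tPrefix-+ k r r< = begin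
  tPrefix (length (Φ k l0) + r)                    ≡⟨ tPrefix-take (suc k) bound ⟩
  take (length (Φ k l0) + r) (Φ (suc k) l0)        ≡⟨ cong (take _) (Φ-suc-l0 k) ⟩
  take (length (Φ k l0) + r) (Φ k l0 ++ Φ k l1)    ≡⟨ take-++-length (Φ k l0) r (Φ k l1) ⟩
  Φ k l0 ++ take r (Φ k l1)                        ≡⟨ cong (Φ k l0 ++_) (take-Φ-l1≡take-Φ-l0 k r r<) ⟩
  Φ k l0 ++ take r (Φ k l0)                        ≡⟨ cong (Φ k l0 ++_) (tPrefix-take k r≤) ⟨
  Φ k l0 ++ tPrefix r                              ∎
  where
  r≤ : r ≤ length (Φ k l0)
  r≤ = ≤-trans (<⇒≤ r<) (Φ-length-l1≤l0 k)
  bound : length (Φ k l0) + r ≤ length (Φ (suc k) l0)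
  bound = ≤-trans (+-monoʳ-≤ (length (Φ k l0)) (<⇒≤ r<)) (≤-reflexive (sym (Φ-length-suc-l0 k)))

infix 4 _≡φ⁺_

data _≡φ⁺_ (v u : Word) : Set where
  φ-image    : v ≡ φ u → v ≡φ⁺ u
  φ-image-l0 : v ≡ φ u ++ [ l0 ] → v ≡φ⁺ u

𝒟-of : ∀ {v u} → v ≡φ⁺ u → Pair → List Pair
𝒟-of (φ-image _)    = 𝒟₀
𝒟-of (φ-image-l0 _) = 𝒟₁

≡φ⁺-∷ : ∀ a {v u} → v ≡φ⁺ u → φ₁ a ++ v ≡φ⁺ a ∷ u
≡φ⁺-∷ a (φ-image e)    = φ-image (cong (φ₁ a ++_) e)
≡φ⁺-∷ a {u = u} (φ-image-l0 e) = φ-image-l0 (trans (cong (φ₁ a ++_) e) (sym (++-assoc (φ₁ a) (φ u) [ l0 ])))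

φ-prefix : ∀ P m → m ≤ length (φ P) → ∃[ n ] n ≤ length P × take m (φ P) ≡φ⁺ take n P
φ-prefix P        zero          _ = 0 , z≤n , φ-image refl
φ-prefix (l0 ∷ P) (suc zero)    _ = 0 , z≤n , φ-image-l0 refl
φ-prefix (l1 ∷ P) (suc zero)    _ = 0 , z≤n , φ-image-l0 refl
φ-prefix (l0 ∷ P) (suc (suc m)) (s≤s (s≤s m≤)) with φ-prefix P m m≤
... | n , n≤ , e = suc n , s≤s n≤ , ≡φ⁺-∷ l0 e
φ-prefix (l1 ∷ P) (suc (suc m)) (s≤s (s≤s m≤)) with φ-prefix P m m≤
... | n , n≤ , e = suc n , s≤s n≤ , ≡φ⁺-∷ l1 e
φ-prefix (l2 ∷ P) (suc m)       (s≤s m≤) with φ-prefix P m m≤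
... | n , n≤ , e = suc n , s≤s n≤ , ≡φ⁺-∷ l2 e

tPrefix-desubstitute : ∀ K {m} → m ≤ length (Φ (suc K) l0) →
  ∃[ n ] n ≤ length (Φ K l0) × tPrefix m ≡φ⁺ tPrefix n
tPrefix-desubstitute K {m} m≤ with φ-prefix (Φ K l0) m m≤
... | n , n≤ , e rewrite sym (tPrefix-take (suc K) m≤) | sym (tPrefix-take K n≤) = n , n≤ , e

spellT : List ℕ → Word
spellT []           = []
spellT (zero ∷ ds)  = spellT ds
spellT (suc d ∷ ds) = Φ (length ds) l0 ++ spellT (d ∷ ds)

spellT-stripZeros : ∀ ds → spellT (stripZeros ds) ≡ spellT ds
spellT-stripZeros []           = refl
spellT-stripZeros (zero ∷ ds)  = spellT-stripZeros ds
spellT-stripZeros (suc d ∷ ds) = refl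

spellT-∷ʳ : ∀ ds d → spellT (ds ∷ʳ d) ≡ φ (spellT ds) ++ replicate d l0
spellT-∷ʳ []           zero    = refl
spellT-∷ʳ []           (suc d) = cong (l0 ∷_) (spellT-∷ʳ [] d)
spellT-∷ʳ (zero ∷ ds)  d       = spellT-∷ʳ ds d
spellT-∷ʳ (suc x ∷ ds) d       = begin
  Φ (length (ds ∷ʳ d)) l0 ++ spellT (x ∷ ds ∷ʳ d)
    ≡⟨ cong₂ (λ i w → Φ i l0 ++ w) (length-∷ʳ ds) (spellT-∷ʳ (x ∷ ds) d) ⟩
  φ (Φ (length ds) l0) ++ (φ (spellT (x ∷ ds)) ++ replicate d l0)
    ≡⟨ ++-assoc (φ (Φ (length ds) l0)) _ _ ⟨
  (φ (Φ (length ds) l0) ++ φ (spellT (x ∷ ds))) ++ replicate d l0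
    ≡⟨ cong (_++ replicate d l0) (φ-++ (Φ (length ds) l0) _) ⟨
  φ (spellT (suc x ∷ ds)) ++ replicate d l0
    ∎
  where
  length-∷ʳ : ∀ (xs : List ℕ) → length (xs ∷ʳ d) ≡ suc (length xs)
  length-∷ʳ xs = trans (length-++ xs) (+-comm (length xs) 1)

Φ-length≡T : ∀ j → length (Φ j l0) ≡ T (j + 3)
Φ-length≡T j = trans (Φ-length-l0 j) (cong T (+-comm 3 j))

length-greedy : ∀ j r → length (greedy j r) ≡ j
length-greedy zero    r = refl
length-greedy (suc j) r with T (j + 3) ≤ᵇ r
... | true  = cong suc (length-greedy j _)
... | false = cong suc (length-greedy j _)

tPrefix-greedy : ∀ j r → r < length (Φ j l0) → tPrefix r ≡ spellT (greedy j r)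
tPrefix-greedy zero    zero    _ = refl
tPrefix-greedy zero    (suc _) (s≤s ())
tPrefix-greedy (suc j) r r<
  with T (j + 3) ≤ᵇ r | ≤ᵇ-reflects-≤ (T (j + 3)) r
... | _ | ofⁿ r≱ = tPrefix-greedy j r (subst (r <_) (sym (Φ-length≡T j)) (≰⇒> r≱))
... | _ | ofʸ T≤r = begin
  tPrefix r                                          ≡⟨ cong tPrefix r≡ ⟨
  tPrefix (length (Φ j l0) + r′)                     ≡⟨ tPrefix-+ j r′ r′< ⟩
  Φ j l0 ++ tPrefix r′                               ≡⟨ cong (Φ j l0 ++_) (tPrefix-greedy j r′ r′<′) ⟩
  Φ j l0 ++ spellT (greedy j r′)                     ≡⟨ cong (λ i → Φ i l0 ++ spellT (greedy j r′)) (length-greedy j r′) ⟨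
  Φ (length (greedy j r′)) l0 ++ spellT (greedy j r′) ∎
  where
  r′ = r ∸ T (j + 3)
  r≡ : length (Φ j l0) + r′ ≡ r
  r≡ = trans (cong (_+ r′) (Φ-length≡T j)) (m+[n∸m]≡n T≤r)
  r′< : r′ < length (Φ j l1)
  r′< = +-cancelˡ-< (length (Φ j l0)) r′ _ (subst₂ _<_ (sym r≡) (Φ-length-suc-l0 j) r<)
  r′<′ : r′ < length (Φ j l0)
  r′<′ = ≤-trans r′< (Φ-length-l1≤l0 j)

tPrefix-⟨⟩T : ∀ N → tPrefix N ≡ spellT ⟨ N ⟩T
tPrefix-⟨⟩T N = trans (tPrefix-greedy (suc N) N N<) (sym (spellT-stripZeros (greedy (suc N) N)))
  where
  N< : N < length (Φ (suc N) l0)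
  N< = ≤-trans (<-Φ-length N) (Φ-length-mono (n≤1+n N))

greedy-digits : ∀ j r → All (_≤ 1) (greedy j r)
greedy-digits zero    r = []
greedy-digits (suc j) r with T (j + 3) ≤ᵇ r
... | true  = s≤s z≤n ∷ greedy-digits j _
... | false = z≤n ∷ greedy-digits j _

All-stripZeros : ∀ {P : ℕ → Set} {ds} → All P ds → All P (stripZeros ds)
All-stripZeros {ds = []}          ps       = ps
All-stripZeros {ds = zero ∷ _}    (_ ∷ ps) = All-stripZeros ps
All-stripZeros {ds = suc _ ∷ _}   ps       = ps

⟨⟩T-digits : ∀ N → All (_≤ 1) ⟨ N ⟩T
⟨⟩T-digits N = All-stripZeros (greedy-digits (suc N) N)

tPrefix-drop-last-digit : ∀ N n ds d₀ → ⟨ N ⟩T ≡ ds ∷ʳ d₀ → ⟨ n ⟩T ≡ ds →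
  tPrefix N ≡φ⁺ tPrefix n
tPrefix-drop-last-digit N n ds d₀ N≡ n≡ =
  by-digit d₀ (proj₂ (∷ʳ⁻ (subst (All (_≤ 1)) N≡ (⟨⟩T-digits N)))) (begin
    tPrefix N                              ≡⟨ tPrefix-⟨⟩T N ⟩
    spellT ⟨ N ⟩T                          ≡⟨ cong spellT N≡ ⟩
    spellT (ds ∷ʳ d₀)                      ≡⟨ spellT-∷ʳ ds d₀ ⟩
    φ (spellT ds) ++ replicate d₀ l0       ≡⟨ cong (λ w → φ (spellT w) ++ replicate d₀ l0) n≡ ⟨
    φ (spellT ⟨ n ⟩T) ++ replicate d₀ l0   ≡⟨ cong (λ w → φ w ++ replicate d₀ l0) (tPrefix-⟨⟩T n) ⟨
    φ (tPrefix n) ++ replicate d₀ l0       ∎)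
  where
  by-digit : ∀ d → d ≤ 1 → tPrefix N ≡ φ (tPrefix n) ++ replicate d l0 → tPrefix N ≡φ⁺ tPrefix n
  by-digit 0 _ e = φ-image (trans e (++-identityʳ _))
  by-digit 1 _ e = φ-image-l0 e
  by-digit (suc (suc _)) (s≤s ()) _

≐-setoid : Setoid _ _
≐-setoid = record
  { Carrier       = List Pair
  ; _≈_           = _≐_
  ; isEquivalence = record
    { refl  = λ _ → ⇔.refl
    ; sym   = λ e x → ⇔.sym (e x)
    ; trans = λ e f x → ⇔.trans (e x) (f x)
    }
  }

open Setoid ≐-setoid using () renaming (refl to ≐-refl; sym to ≐-sym; trans to ≐-trans; reflexive to ≡⇒≐)

⊆-antisym : ∀ {A B} → A ⊆ B → B ⊆ A → A ≐ B
⊆-antisym A⊆B B⊆A _ = mk⇔ A⊆B B⊆A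

⋃-cong : ∀ {A B} D → A ≐ B → ⋃ A D ≐ ⋃ B D
⋃-cong D A≐B x = mk⇔ (concatMap⁺ D (Equivalence.to (A≐B _))) (concatMap⁺ D (Equivalence.from (A≐B _)))

_≟ˡ_ : DecidableEquality Letter
l0 ≟ˡ l0 = yes refl
l1 ≟ˡ l1 = yes refl
l2 ≟ˡ l2 = yes refl
l0 ≟ˡ l1 = no λ ()
l0 ≟ˡ l2 = no λ ()
l1 ≟ˡ l0 = no λ ()
l1 ≟ˡ l2 = no λ ()
l2 ≟ˡ l0 = no λ ()
l2 ≟ˡ l1 = no λ ()

_≟ᵖ_ : DecidableEquality Pair
_≟ᵖ_ = ×-≡-dec (List-≡-dec _≟ˡ_) (List-≡-dec _≟ˡ_)

open import Data.List.Relation.Binary.Subset.DecPropositional _≟ᵖ_ using (_⊆?_)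

-- Both sides are closed terms, so the inclusions are decided by evaluation.
𝒵K-0≐1 : ∀ m → m ≤ 1 → 𝒵K 0 m ≐ 𝒵K 1 m
𝒵K-0≐1 0 _ = ⊆-antisym (from-yes (𝒵K 0 0 ⊆? 𝒵K 1 0)) (from-yes (𝒵K 1 0 ⊆? 𝒵K 0 0))
𝒵K-0≐1 1 _ = ⊆-antisym (from-yes (𝒵K 0 1 ⊆? 𝒵K 1 1)) (from-yes (𝒵K 1 1 ⊆? 𝒵K 0 1))
𝒵K-0≐1 (suc (suc _)) (s≤s ())

𝒵K-suc : ∀ K m n → n ≤ length (Φ (K + 3) l0) → (e : tPrefix m ≡φ⁺ tPrefix n) →
  𝒵K (suc K) m ≡ ⋃ (𝒵K K n) (𝒟-of e)
𝒵K-suc K m n n≤ (φ-image e) =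
  trans (cong (λ v → Dec-rotate v (Φ (suc K + 3) l0)) e) (Dec-φ-rotate (tPrefix-≼ (K + 3) n≤))
𝒵K-suc K m n n≤ (φ-image-l0 e) =
  trans (cong (λ v → Dec-rotate v (Φ (suc K + 3) l0)) e) (Dec-φ0-rotate (tPrefix-≼ (K + 3) n≤))

𝒵K-suc-≐ : ∀ K {m} → m ≤ length (Φ K l0) → 𝒵K K m ≐ 𝒵K (suc K) m
𝒵K-suc-≐ zero    {m} m≤ = 𝒵K-0≐1 m m≤
𝒵K-suc-≐ (suc K) {m} m≤ with tPrefix-desubstitute K m≤
... | n , n≤ , e =
  ≐-trans (≡⇒≐ (𝒵K-suc K m n (≤-trans n≤ (Φ-length-mono (m≤m+n K 3))) e))
  (≐-trans (⋃-cong (𝒟-of e) (𝒵K-suc-≐ K n≤))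
           (≡⇒≐ (sym (𝒵K-suc (suc K) m n (≤-trans n≤ (Φ-length-mono (m≤n⇒m≤1+n (m≤m+n K 3)))) e))))

𝒵K-≤′ : ∀ {a b m} → a ≤′ b → m ≤ length (Φ a l0) → 𝒵K a m ≐ 𝒵K b m
𝒵K-≤′ (≤′-reflexive refl) _  = ≐-refl
𝒵K-≤′ (≤′-step {b} a≤′b)  m≤ = ≐-trans (𝒵K-≤′ a≤′b m≤)
  (𝒵K-suc-≐ b (≤-trans m≤ (Φ-length-mono (≤′⇒≤ a≤′b))))

𝒵K-independent : ∀ a b {m} → m ≤ length (Φ a l0) → m ≤ length (Φ b l0) → 𝒵K a m ≐ 𝒵K b m
𝒵K-independent a b ma mb with ≤-total a b
... | inj₁ a≤b = 𝒵K-≤′ (≤⇒≤′ a≤b) ma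
... | inj₂ b≤a = ≐-sym (𝒵K-≤′ (≤⇒≤′ b≤a) mb)

𝒵-desubstitute : ∀ m n (e : tPrefix m ≡φ⁺ tPrefix n) → 𝒵 m ≐ ⋃ (𝒵 n) (𝒟-of e)
𝒵-desubstitute m n e =
  ≐-trans (𝒵K-independent m (suc K) (≤-Φ-length ≤-refl) (≤-Φ-length (m≤n⇒m≤1+n (m≤m+n m n))))
  (≐-trans (≡⇒≐ (𝒵K-suc K m n (≤-Φ-length (≤-trans (m≤n+m n m) (m≤m+n K 3))) e))
           (⋃-cong (𝒟-of e) (𝒵K-independent K n (≤-Φ-length (m≤n+m n m)) (≤-Φ-length ≤-refl))))
  where
  K = m + n

lemma7 : (N n : ℕ) (ds : List ℕ) (d₀ : ℕ) →
    ⟨ N ⟩T ≡ 1 ∷ (ds ∷ʳ d₀) →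
    ⟨ n ⟩T ≡ 1 ∷ ds →
    (𝒵 N ≐ ⋃ (𝒵 n) 𝒟₀) ⊎ (𝒵 N ≐ ⋃ (𝒵 n) 𝒟₁)
lemma7 N n ds d₀ N≡ n≡ with tPrefix-drop-last-digit N n (1 ∷ ds) d₀ N≡ n≡
... | φ-image e    = inj₁ (𝒵-desubstitute N n (φ-image e))
... | φ-image-l0 e = inj₂ (𝒵-desubstitute N n (φ-image-l0 e))
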